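{- Let $\alpha<\mathfrak c$ be an ordinal and let $\mathcal F=\{f_i:i<\alpha\}\subset\omega^\omega$ be a family of finite-to-one functions. Suppose that for all $i<j<\alpha$ there is $l<\omega$ such that $f_j(n)=f_j(m)$ whenever $f_i(n)=f_i(m)$ and $n,m\ge l$. Then for each finite $A\subseteq\alpha$ and each $n<\omega$ there is a finite $(A,\mathcal F)$-closed set $F\subseteq\omega$ with $n\in F$.
   Context: $\mathfrak c$ denotes the cardinality of the continuum. For an ordinal $\alpha$, a family $\mathcal F=\{f_i:i<\alpha\}\subset\omega^\omega$ and a set $A\subseteq\alpha$, a set $F\subseteq\omega$ is called $(A,\mathcal F)$-closed if $f_i^{ -1}(f_i''F)\subseteq F$ for each $i\in A$, where $f_i''F$ denotes the image of $F$ under $f_i$. -}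

module Defs where

open import Level using (0ℓ)
open import Data.Nat using (ℕ; _<_; _≤_)
open import Data.Bool using (Bool)
open import Data.Product using (Σ; ∃; _×_)
open import Data.List using (List)
open import Data.List.Membership.Propositional using (_∈_)
open import Relation.Nullary using (¬_)
open import Relation.Binary.Core using (Rel)
open import Induction.WellFounded using (WellFounded)
open import Relation.Binary.Structures using (IsStrictTotalOrder)
open import Relation.Binary.PropositionalEquality using (_≡_)
open import Function.Definitions using (Injective)

-- An ordinal α is represented (up to order isomorphism) by its set of
-- elements {i : i < α} carried by a type I with a strict well-order _≺_.
record Ordinal : Set₁ where
  field
    Elt  : Set
    _≺_  : Rel Elt 0ℓ
    isSTO : IsStrictTotalOrder _≡_ _≺_
    wf   : WellFounded _≺_

BelowContinuum : Ordinal → Set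
BelowContinuum α = ¬ (Σ ((ℕ → Bool) → Ordinal.Elt α) λ g → Injective _≡_ _≡_ g)

FiniteToOne : (ℕ → ℕ) → Set
FiniteToOne f = ∀ k → ∃ λ b → ∀ m → f m ≡ k → m < b

-- F (a finite subset of ω, given as a list) is (A,𝓕)-closed:
-- f_i⁻¹(f_i '' F) ⊆ F for every i ∈ A.
Closed : {I : Set} → (I → ℕ → ℕ) → List I → List ℕ → Set
Closed f A F = ∀ i → i ∈ A → ∀ m → (∃ λ k → k ∈ F × f i m ≡ f i k) → m ∈ F

-- Let j be the largest index in A. Beyond a common threshold L, every f i
-- with i ∈ A identifies only points already identified by f j. So start from
-- T = {n} ∪ [0, L), saturate it under each f i (this handles identifications
-- with a point below L), and then saturate the result under f j (this handles
-- identifications between points above L). All saturations are finite because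
-- the functions are finite-to-one.
module Submission where

open import Defs
open import Data.Nat using (ℕ; _≤_; _⊔_)
open import Data.Nat.Properties using (_≟_; _<?_; ≤-trans; m≤m⊔n; m≤n⊔m; ≮⇒≥)
open import Data.Product using (∃; _×_; _,_; proj₁; proj₂)
open import Data.Sum using (inj₁; inj₂)
open import Data.List using (List; []; _∷_; _++_; filter; upTo; concatMap)
open import Data.List.Relation.Unary.Any using (here; there)
import Data.List.Relation.Unary.All as All
open import Data.List.Membership.Propositional using (_∈_; find; lose)
open import Data.List.Membership.Propositional.Properties
  using (∈-filter⁺; ∈-filter⁻; ∈-upTo⁺; ∈-++⁺ˡ; ∈-++⁺ʳ; ∈-concatMap⁺; ∈-concatMap⁻)
open import Relation.Binary.PropositionalEquality using (_≡_; refl; trans; subst)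
open import Relation.Binary.Bundles using (TotalOrder)
open import Relation.Nullary using (yes; no)
import Relation.Binary.Construct.StrictToNonStrict as StrictToNonStrict
import Data.List.Extrema as Extrema

fibre : (g : ℕ → ℕ) → FiniteToOne g → ℕ → List ℕ
fibre g fin k = filter (λ m → g m ≟ k) (upTo (proj₁ (fin k)))

∈-fibre⁺ : ∀ g fin m → m ∈ fibre g fin (g m)
∈-fibre⁺ g fin m =
  ∈-filter⁺ (λ x → g x ≟ g m) (∈-upTo⁺ (proj₂ (fin (g m)) m refl)) refl

∈-fibre⁻ : ∀ g fin {k m} → m ∈ fibre g fin k → g m ≡ k
∈-fibre⁻ g fin {k} m∈ = proj₂ (∈-filter⁻ (λ m → g m ≟ k) {xs = upTo (proj₁ (fin k))} m∈)

saturate : (g : ℕ → ℕ) → FiniteToOne g → List ℕ → List ℕ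
saturate g fin = concatMap (λ x → fibre g fin (g x))

∈-saturate⁺ : ∀ g fin {X x m} → x ∈ X → g m ≡ g x → m ∈ saturate g fin X
∈-saturate⁺ g fin {m = m} x∈X gm≡gx =
  ∈-concatMap⁺ _ (lose x∈X (subst (λ k → m ∈ fibre g fin k) gm≡gx (∈-fibre⁺ g fin m)))

∈-saturate⁻ : ∀ g fin {X m} → m ∈ saturate g fin X → ∃ λ x → x ∈ X × g m ≡ g x
∈-saturate⁻ g fin m∈ with find (∈-concatMap⁻ _ m∈)
... | x , x∈X , m∈fibre = x , x∈X , ∈-fibre⁻ g fin m∈fibre

⊆-saturate : ∀ g fin {X x} → x ∈ X → x ∈ saturate g fin X
⊆-saturate g fin x∈X = ∈-saturate⁺ g fin x∈X refl

RefinesFrom : ℕ → (ℕ → ℕ) → (ℕ → ℕ) → Set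
RefinesFrom l h g = ∀ n m → l ≤ n → l ≤ m → h n ≡ h m → g n ≡ g m

RefinesFrom-mono : ∀ {l l′ h g} → l ≤ l′ → RefinesFrom l h g → RefinesFrom l′ h g
RefinesFrom-mono l≤l′ ref n m l′≤n l′≤m = ref n m (≤-trans l≤l′ l′≤n) (≤-trans l≤l′ l′≤m)

common-threshold : ∀ {I : Set} {P : ℕ → I → Set} →
  (∀ {l l′ i} → l ≤ l′ → P l i → P l′ i) →
  (A : List I) → (∀ i → i ∈ A → ∃ λ l → P l i) → ∃ λ L → ∀ i → i ∈ A → P L i
common-threshold mono [] _ = 0 , λ _ ()
common-threshold mono (a ∷ A) bound
  with bound a (here refl) | common-threshold mono A (λ i i∈A → bound i (there i∈A))
... | l , Pla | L , PLA = l ⊔ L , λ where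
  i (here refl) → mono (m≤m⊔n l L) Pla
  i (there i∈A) → mono (m≤n⊔m l L) (PLA i i∈A)

closed-by-refinement : ∀ {I : Set} (f : I → ℕ → ℕ) → (∀ i → FiniteToOne (f i)) →
  (g : ℕ → ℕ) → FiniteToOne g → (A : List I) (L : ℕ) →
  (∀ i → i ∈ A → RefinesFrom L (f i) g) →
  (n : ℕ) → ∃ λ (F : List ℕ) → n ∈ F × Closed f A F
closed-by-refinement f fin g gfin A L refines n =
  F , ⊆-saturate g gfin (T⊆U (here refl)) , closed
  where
  T U F : List ℕ
  T = n ∷ upTo L
  U = T ++ concatMap (λ i → saturate (f i) (fin i) T) A
  F = saturate g gfin U

  T⊆U : ∀ {m} → m ∈ T → m ∈ U
  T⊆U = ∈-++⁺ˡ

  f-saturated-U : ∀ {i m v} → i ∈ A → v ∈ T → f i m ≡ f i v → m ∈ U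
  f-saturated-U i∈A v∈T fm≡fv =
    ∈-++⁺ʳ T (∈-concatMap⁺ _ {xs = A} (lose i∈A (∈-saturate⁺ (f _) (fin _) v∈T fm≡fv)))

  closed : Closed f A F
  closed i i∈A m (v , v∈F , fm≡fv) with m <? L | v <? L
  ... | yes m<L | _ = ⊆-saturate g gfin (T⊆U (there (∈-upTo⁺ m<L)))
  ... | no _ | yes v<L = ⊆-saturate g gfin (f-saturated-U i∈A (there (∈-upTo⁺ v<L)) fm≡fv)
  ... | no m≮L | no v≮L with ∈-saturate⁻ g gfin {X = U} v∈F
  ... | u , u∈U , gv≡gu =
    ∈-saturate⁺ g gfin u∈U (trans (refines i i∈A m v (≮⇒≥ m≮L) (≮⇒≥ v≮L) fm≡fv) gv≡gu)

≼-totalOrder : Ordinal → TotalOrder _ _ _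
≼-totalOrder α = record { isTotalOrder = StrictToNonStrict.isTotalOrder _≡_ _≺_ isSTO }
  where open Ordinal α

lemma2p4 : (α : Ordinal) → BelowContinuum α →
    (f : Ordinal.Elt α → ℕ → ℕ) →
    (∀ i → FiniteToOne (f i)) →
    (∀ i j → Ordinal._≺_ α i j → ∃ λ l → ∀ n m → l ≤ n → l ≤ m → f i n ≡ f i m → f j n ≡ f j m) →
    (A : List (Ordinal.Elt α)) → (n : ℕ) →
    ∃ λ (F : List ℕ) → n ∈ F × Closed f A F
lemma2p4 α _ f fin eventually-refines [] n = n ∷ [] , here refl , λ _ ()
lemma2p4 α _ f fin eventually-refines A@(a ∷ _) n =
  let L , refines = common-threshold RefinesFrom-mono A
                      λ i i∈A → threshold (All.lookup (xs≤max a A) i∈A)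
  in closed-by-refinement f fin (f top) (fin top) A L refines n
  where
  open TotalOrder (≼-totalOrder α) using () renaming (_≤_ to _≼_)
  open Extrema (≼-totalOrder α) using (max; xs≤max)

  top : Ordinal.Elt α
  top = max a A

  threshold : ∀ {i} → i ≼ top → ∃ λ l → RefinesFrom l (f i) (f top)
  threshold (inj₁ i≺top) = eventually-refines _ top i≺top
  threshold (inj₂ refl) = 0 , λ _ _ _ _ fn≡fm → fn≡fm
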